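{- For any integers $n\geq 0$ and $k\geq 0$, $$p_{n,n+k;\leq n+k}=\sum_{\substack{r_0+\cdots+r_k=n\\ r_i\geq 0}}\binom{n}{r_0,\dots,r_k}\prod_{i=0}^{k}(r_i+1)^{r_i-1}.$$
   Context: Given $m$ parking spaces in a line numbered $1,\dots,m$, $n$ cars arrive in order; car $j$ has preference $a_j\in[m]$ and parks in the first unoccupied space numbered $\geq a_j$, if any. $(a_1,\dots,a_n)$ is a parking function (with $m$ spaces) if all cars park. $p_{n,m;\leq m}$ denotes the number of parking functions of length $n$ with $m$ spaces and all $a_j\in[m]$. -}

module Defs where

open import Data.Bool using (Bool; true; false; if_then_else_)
open import Data.Maybe using (Maybe; just; nothing; is-just; _>>=_)
import Data.Maybe as Maybe
open import Data.Nat using (ℕ; zero; suc; _+_; _*_; _∸_; _^_; _/_; NonZero)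
open import Data.Nat.Properties using (_!≢0; m*n≢0)
open import Data.Nat using (_!)
open import Data.Fin using (Fin; toℕ)
import Data.Fin as Fin
open import Data.List using (List; []; _∷_; replicate; length; filter; concatMap; map; upTo)
open import Data.Vec using (Vec; []; _∷_; foldr; allFin)
import Data.Vec as Vec
open import Data.Nat using (_≟_)
open import Relation.Nullary.Decidable using (Dec; yes; no)
open import Relation.Binary.PropositionalEquality using (_≡_)
open import Data.Bool using (T)
open import Relation.Nullary.Decidable using (T?)

-- Parking process.
-- Spaces 1..m are represented by positions 0..m-1 of a list of Booleans
-- (true = occupied).  A preference a ∈ [m] is represented by (a - 1) : Fin m.

parkAt : List Bool → ℕ → Maybe (List Bool)
parkAt []       i       = nothing
parkAt (b ∷ bs) zero    = if b then Maybe.map (b ∷_) (parkAt bs zero) else just (true ∷ bs)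
parkAt (b ∷ bs) (suc i) = Maybe.map (b ∷_) (parkAt bs i)

runCars : List Bool → List ℕ → Maybe (List Bool)
runCars occ []       = just occ
runCars occ (a ∷ as) = parkAt occ a >>= λ occ′ → runCars occ′ as

isPF : ∀ {n} m → Vec (Fin m) n → Bool
isPF m a = is-just (runCars (replicate m false) (Data.List.map toℕ (Vec.toList a)))

IsParkingFunction : ∀ {n} m → Vec (Fin m) n → Set
IsParkingFunction {n} m a = T (isPF m a)

allSeqs : ∀ m n → List (Vec (Fin m) n)
allSeqs m zero    = [] ∷ []
allSeqs m (suc n) = concatMap (λ x → Data.List.map (x ∷_) (allSeqs m n)) (Vec.toList (allFin m))

pf : ℕ → ℕ → ℕ
pf n m = length (filter (λ a → T? (isPF m a)) (allSeqs m n))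

prodFact : ∀ {l} → Vec ℕ l → ℕ
prodFact = foldr _ (λ r acc → r ! * acc) 1

prodFact≢0 : ∀ {l} (v : Vec ℕ l) → NonZero (prodFact v)
prodFact≢0 []      = _
prodFact≢0 (r ∷ v) = m*n≢0 (r !) (prodFact v) {{r !≢0}} {{prodFact≢0 v}}

multinomial : ∀ {l} → ℕ → Vec ℕ l → ℕ
multinomial n rs = _/_ (n !) (prodFact rs) {{prodFact≢0 rs}}

-- ∏ (rᵢ+1)^(rᵢ-1); for rᵢ = 0 the factor 1^(-1) = 1 equals 1^0 in ℕ
prodTerm : ∀ {l} → Vec ℕ l → ℕ
prodTerm = foldr _ (λ r acc → (r + 1) ^ (r ∸ 1) * acc) 1

vecsBelow : ℕ → ∀ l → List (Vec ℕ l)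
vecsBelow b zero    = [] ∷ []
vecsBelow b (suc l) = concatMap (λ x → Data.List.map (x ∷_) (vecsBelow b l)) (upTo b)

compositions : ℕ → ∀ l → List (Vec ℕ l)
compositions n l = filter (λ r → Vec.sum r ≟ n) (vecsBelow (suc n) l)

sumList : List ℕ → ℕ
sumList = Data.List.foldr _+_ 0

rhs : ℕ → ℕ → ℕ
rhs n k = sumList (Data.List.map (λ r → multinomial n r * prodTerm r) (compositions n (suc k)))

module Submission where

open import Defs
open import Data.Nat using (ℕ; _+_)
open import Relation.Binary.PropositionalEquality using (_≡_)

open import Data.Nat using (zero; suc; _*_; _∸_; _^_; _≤_; _<_; z≤n; s≤s; _!; _≟_)
open import Data.Nat.Properties hiding (_≟_)
open import Data.Nat.Combinatorics using (_C_; nCk≡n!/k![n-k]!; k![n∸k]!∣n!; k>n⇒nCk≡0; nCn≡1; nCk+nC[k+1]≡[n+1]C[k+1])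
open import Data.Nat.DivMod using (_/_; m*n/n≡m; m/n*n≡m)
open import Data.Nat.Tactic.RingSolver using (solve-∀)
open import Data.Bool using (Bool; true; false; if_then_else_; T)
open import Data.Maybe using (Maybe; just; nothing; is-just; _>>=_; _<∣>_)
import Data.Maybe as Maybe
open import Data.Maybe.Properties using (map-id; map-∘)
open import Data.List using (List; []; _∷_; _++_; length; filter; concatMap; map; upTo; applyUpTo; replicate; take; drop)
open import Data.List.Properties using (length-++; ++-assoc; ++-identityʳ; length-replicate)
open import Data.Vec using (Vec; []; _∷_; tabulate; allFin; toList)
import Data.Vec as Vec
open import Data.Fin using (Fin; toℕ)
import Data.Fin as Fin
open import Relation.Nullary using (¬_; Dec; yes; no; does)
open import Relation.Nullary.Decidable using (T?)
open import Relation.Binary.PropositionalEquality using (refl; sym; trans; cong; cong₂; subst; _≢_; module ≡-Reasoning)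
open import Relation.Binary.Definitions using (tri<; tri≈; tri>)
open import Function using (_∘_; id)
open import Data.Empty using (⊥; ⊥-elim)
open import Data.Unit using (tt)
open import Data.Product using (_,_; ∃)

-- Write p(n,m) for pf n m.  Every count below is a weighted
-- sum over the runs of a parking process: `runs step N W occ n` adds up, over
-- all preference sequences in [N]ⁿ, the weight W of the final occupancy when
-- every car parks (0 otherwise); thus p(n,m) = runs parkAt m 1 ∅ n.  General
-- facts about `runs` (linearity in W, weights depending only on the number of
-- free spaces, splitting a lot at a free space into a binomial convolution of
-- the two sides) then give
--  (1) Pollak's theorem p(m,m) = (m+1)^(m-1): on a circle of m+1 spaces all
--      (m+1)^m runs succeed and leave one space free; by rotation symmetry
--      each space is the free one equally often, and runs leaving the first
--      space free are the linear parking functions on the other m spaces;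
--  (2) the decomposition by the first space left free,
--      p(n, n+k+1) = Σ_j C(n,j) p(j,j) p(n-j, n-j+k);
--  (3) the same recursion for the right-hand side, by splitting off the
--      first part r₀ of a composition (r₀,…,r_{k+1}) of n.
-- The theorem follows by induction on k.

Σ< : ℕ → (ℕ → ℕ) → ℕ
Σ< zero    f = 0
Σ< (suc n) f = f 0 + Σ< n (f ∘ suc)

Σ-cong< : ∀ n {f g : ℕ → ℕ} → (∀ i → i < n → f i ≡ g i) → Σ< n f ≡ Σ< n g
Σ-cong< zero    h = refl
Σ-cong< (suc n) h = cong₂ _+_ (h 0 (s≤s z≤n)) (Σ-cong< n (λ i i<n → h (suc i) (s≤s i<n)))

Σ-cong : ∀ n {f g : ℕ → ℕ} → (∀ i → f i ≡ g i) → Σ< n f ≡ Σ< n g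
Σ-cong n h = Σ-cong< n (λ i _ → h i)

Σ-+ : ∀ n (f g : ℕ → ℕ) → Σ< n (λ i → f i + g i) ≡ Σ< n f + Σ< n g
Σ-+ zero    f g = refl
Σ-+ (suc n) f g = trans (cong (f 0 + g 0 +_) (Σ-+ n (f ∘ suc) (g ∘ suc)))
                        (interchange (f 0) (g 0) (Σ< n (f ∘ suc)) (Σ< n (g ∘ suc)))
  where
  interchange : ∀ a b c d → (a + b) + (c + d) ≡ (a + c) + (b + d)
  interchange = solve-∀

Σ-*ˡ : ∀ n c (f : ℕ → ℕ) → Σ< n (λ i → c * f i) ≡ c * Σ< n f
Σ-*ˡ zero    c f = sym (*-zeroʳ c)
Σ-*ˡ (suc n) c f = trans (cong (c * f 0 +_) (Σ-*ˡ n c (f ∘ suc))) (sym (*-distribˡ-+ c (f 0) _))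

Σ-*ʳ : ∀ n c (f : ℕ → ℕ) → Σ< n (λ i → f i * c) ≡ Σ< n f * c
Σ-*ʳ zero    c f = refl
Σ-*ʳ (suc n) c f = trans (cong (f 0 * c +_) (Σ-*ʳ n c (f ∘ suc))) (sym (*-distribʳ-+ c (f 0) _))

Σ-const : ∀ n c → Σ< n (λ _ → c) ≡ n * c
Σ-const zero    c = refl
Σ-const (suc n) c = cong (c +_) (Σ-const n c)

Σ-zero : ∀ n (f : ℕ → ℕ) → (∀ i → i < n → f i ≡ 0) → Σ< n f ≡ 0
Σ-zero n f h = trans (Σ-cong< n h) (trans (Σ-const n 0) (*-zeroʳ n))

Σ-split : ∀ a b (f : ℕ → ℕ) → Σ< (a + b) f ≡ Σ< a f + Σ< b (λ j → f (a + j))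
Σ-split zero    b f = refl
Σ-split (suc a) b f = trans (cong (f 0 +_) (Σ-split a b (f ∘ suc))) (sym (+-assoc (f 0) _ _))

Σ-last : ∀ n (f : ℕ → ℕ) → Σ< (suc n) f ≡ Σ< n f + f n
Σ-last zero    f = +-comm (f 0) 0
Σ-last (suc n) f = trans (cong (f 0 +_) (Σ-last n (f ∘ suc))) (sym (+-assoc (f 0) _ _))

Σ-single : ∀ n j (f : ℕ → ℕ) → j < n → (∀ i → i < n → i ≢ j → f i ≡ 0) → Σ< n f ≡ f j
Σ-single (suc n) zero f _ h =
  trans (cong (f 0 +_) (Σ-zero n (f ∘ suc) (λ i i<n → h (suc i) (s≤s i<n) λ ()))) (+-identityʳ (f 0))
Σ-single (suc n) (suc j) f (s≤s j<n) h =
  trans (cong (_+ Σ< n (f ∘ suc)) (h 0 (s≤s z≤n) λ ()))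
        (Σ-single n j (f ∘ suc) j<n (λ i i<n i≢j → h (suc i) (s≤s i<n) (i≢j ∘ suc-injective)))

Σ-swap : ∀ n m (f : ℕ → ℕ → ℕ) → Σ< n (λ i → Σ< m (f i)) ≡ Σ< m (λ j → Σ< n (λ i → f i j))
Σ-swap zero    m f = sym (Σ-zero m _ (λ _ _ → refl))
Σ-swap (suc n) m f = trans (cong (Σ< m (f 0) +_) (Σ-swap n m (f ∘ suc))) (sym (Σ-+ m (f 0) _))

orZero : {A : Set} → (A → ℕ) → Maybe A → ℕ
orZero f nothing  = 0
orZero f (just x) = f x

orZero-cong : {A : Set} {f g : A → ℕ} (x : Maybe A) → (∀ o → x ≡ just o → f o ≡ g o) → orZero f x ≡ orZero g x
orZero-cong nothing  h = refl
orZero-cong (just x) h = h x refl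

orZero-zero : {A : Set} {f : A → ℕ} (x : Maybe A) → (∀ o → x ≡ just o → f o ≡ 0) → orZero f x ≡ 0
orZero-zero nothing  h = refl
orZero-zero (just x) h = h x refl

orZero-map : {A B : Set} (f : B → ℕ) (g : A → B) (x : Maybe A) → orZero f (Maybe.map g x) ≡ orZero (f ∘ g) x
orZero-map f g nothing  = refl
orZero-map f g (just x) = refl

orZero-∘ : {A : Set} (h : ℕ → ℕ) (f : A → ℕ) (x : Maybe A) → h 0 ≡ 0 → orZero (h ∘ f) x ≡ h (orZero f x)
orZero-∘ h f nothing  h0 = sym h0
orZero-∘ h f (just x) h0 = refl

orZero-Σ : {A : Set} (J : ℕ) (h : A → ℕ → ℕ) (x : Maybe A) → orZero (λ o → Σ< J (h o)) x ≡ Σ< J (λ j → orZero (λ o → h o j) x)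
orZero-Σ J h nothing  = sym (Σ-zero J _ (λ _ _ → refl))
orZero-Σ J h (just x) = refl

𝟙 : {P : Set} → Dec P → ℕ
𝟙 d = if does d then 1 else 0

sumList-cong : {A : Set} {f g : A → ℕ} (xs : List A) → (∀ x → f x ≡ g x) → sumList (map f xs) ≡ sumList (map g xs)
sumList-cong []       h = refl
sumList-cong (x ∷ xs) h = cong₂ _+_ (h x) (sumList-cong xs h)

sumList-zero : {A : Set} (xs : List A) → sumList (map (λ _ → 0) xs) ≡ 0
sumList-zero []       = refl
sumList-zero (x ∷ xs) = sumList-zero xs

sumList-++ : {A : Set} (g : A → ℕ) (xs ys : List A) → sumList (map g (xs ++ ys)) ≡ sumList (map g xs) + sumList (map g ys)
sumList-++ g []       ys = refl
sumList-++ g (x ∷ xs) ys = trans (cong (g x +_) (sumList-++ g xs ys)) (sym (+-assoc (g x) _ _))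

sumList-concatMap : {A B : Set} (g : B → ℕ) (h : A → List B) (xs : List A) →
  sumList (map g (concatMap h xs)) ≡ sumList (map (λ x → sumList (map g (h x))) xs)
sumList-concatMap g h []       = refl
sumList-concatMap g h (x ∷ xs) =
  trans (sumList-++ g (h x) (concatMap h xs)) (cong (sumList (map g (h x)) +_) (sumList-concatMap g h xs))

sumList-map : {A B : Set} (g : B → ℕ) (f : A → B) (xs : List A) → sumList (map g (map f xs)) ≡ sumList (map (g ∘ f) xs)
sumList-map g f []       = refl
sumList-map g f (x ∷ xs) = cong (g (f x) +_) (sumList-map g f xs)

sumList-upTo : (g : ℕ → ℕ) (b : ℕ) → sumList (map g (upTo b)) ≡ Σ< b g
sumList-upTo g b = go g id b
  where
  go : (g f : ℕ → ℕ) (b : ℕ) → sumList (map g (applyUpTo f b)) ≡ Σ< b (g ∘ f)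
  go g f zero    = refl
  go g f (suc b) = cong (g (f 0) +_) (go g (f ∘ suc) b)

sumList-tabulate : ∀ {A : Set} m (e : Fin m → A) (g : A → ℕ) (f : ℕ → ℕ) → (∀ i → g (e i) ≡ f (toℕ i)) →
  sumList (map g (toList (tabulate e))) ≡ Σ< m f
sumList-tabulate zero    e g f h = refl
sumList-tabulate (suc m) e g f h = cong₂ _+_ (h Fin.zero) (sumList-tabulate m (e ∘ Fin.suc) g (f ∘ suc) (h ∘ Fin.suc))

length-filter : {A : Set} {P : A → Set} (P? : ∀ x → Dec (P x)) (xs : List A) →
  length (filter P? xs) ≡ sumList (map (𝟙 ∘ P?) xs)
length-filter P? []       = refl
length-filter P? (x ∷ xs) with does (P? x)
... | true  = cong suc (length-filter P? xs)
... | false = length-filter P? xs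

sumList-filter : {A : Set} {P : A → Set} (P? : ∀ x → Dec (P x)) (f : A → ℕ) (xs : List A) →
  sumList (map f (filter P? xs)) ≡ sumList (map (λ x → 𝟙 (P? x) * f x) xs)
sumList-filter P? f []       = refl
sumList-filter P? f (x ∷ xs) with does (P? x)
... | true  = cong₂ _+_ (sym (+-identityʳ (f x))) (sumList-filter P? f xs)
... | false = sumList-filter P? f xs

free : List Bool → ℕ
free []          = 0
free (false ∷ s) = suc (free s)
free (true ∷ s)  = free s

emptyLot : ℕ → List Bool
emptyLot m = replicate m false

free-emptyLot : ∀ m → free (emptyLot m) ≡ m
free-emptyLot zero    = refl
free-emptyLot (suc m) = cong suc (free-emptyLot m)

parkAt-fills : ∀ occ i o → parkAt occ i ≡ just o → suc (free o) ≡ free occ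
parkAt-fills []           i       o ()
parkAt-fills (false ∷ bs) zero    .(true ∷ bs) refl = refl
parkAt-fills (true ∷ bs)  zero    o eq with parkAt bs zero in e
parkAt-fills (true ∷ bs)  zero    .(true ∷ o′) refl | just o′ = parkAt-fills bs zero o′ e
parkAt-fills (b ∷ bs)     (suc i) o eq with parkAt bs i in e
parkAt-fills (false ∷ bs) (suc i) .(false ∷ o′) refl | just o′ = cong suc (parkAt-fills bs i o′ e)
parkAt-fills (true ∷ bs)  (suc i) .(true ∷ o′) refl  | just o′ = parkAt-fills bs i o′ e

parkAt-length : ∀ occ i o → parkAt occ i ≡ just o → length o ≡ length occ
parkAt-length []           i       o ()
parkAt-length (false ∷ bs) zero    .(true ∷ bs) refl = refl
parkAt-length (true ∷ bs)  zero    o eq with parkAt bs zero in e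
parkAt-length (true ∷ bs)  zero    .(true ∷ o′) refl | just o′ = cong suc (parkAt-length bs zero o′ e)
parkAt-length (b ∷ bs)     (suc i) o eq with parkAt bs i in e
parkAt-length (b ∷ bs)     (suc i) .(b ∷ o′) refl    | just o′ = cong suc (parkAt-length bs i o′ e)

parkAt-beyond : ∀ xs i → length xs ≤ i → parkAt xs i ≡ nothing
parkAt-beyond []       i       _         = refl
parkAt-beyond (b ∷ xs) (suc i) (s≤s l≤i) rewrite parkAt-beyond xs i l≤i = refl

parkAt-full : ∀ occ → parkAt occ 0 ≡ nothing → free occ ≡ 0
parkAt-full []          _  = refl
parkAt-full (true ∷ bs) eq with parkAt bs zero in e
... | nothing = parkAt-full bs e

parkAt-++ : ∀ xs ys i → parkAt (xs ++ ys) i ≡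
  Maybe.maybe′ (λ x → just (x ++ ys)) (Maybe.map (xs ++_) (parkAt ys (i ∸ length xs))) (parkAt xs i)
parkAt-++ []           ys i = sym (map-id (parkAt ys i))
parkAt-++ (false ∷ xs) ys zero = refl
parkAt-++ (true ∷ xs)  ys zero rewrite parkAt-++ xs ys zero with parkAt xs zero
... | just x  = refl
... | nothing rewrite 0∸n≡0 (length xs) = sym (map-∘ (parkAt ys zero))
parkAt-++ (b ∷ xs) ys (suc i) rewrite parkAt-++ xs ys i with parkAt xs i
... | just x  = refl
... | nothing = sym (map-∘ (parkAt ys (i ∸ length xs)))

Occupied : ℕ → List Bool → Set
Occupied zero    (b ∷ _) = T b
Occupied (suc a) (_ ∷ s) = Occupied a s
Occupied _       []      = ⊥

parkAt-occupied : ∀ a s i o → parkAt s i ≡ just o → Occupied a s → Occupied a o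
parkAt-occupied a       []           i       o ()
parkAt-occupied zero    (false ∷ bs) zero    .(true ∷ bs) refl ()
parkAt-occupied (suc a) (false ∷ bs) zero    .(true ∷ bs) refl p = p
parkAt-occupied a       (true ∷ bs)  zero    o eq p with parkAt bs zero in e
parkAt-occupied zero    (true ∷ bs)  zero    .(true ∷ o′) refl p | just o′ = tt
parkAt-occupied (suc a) (true ∷ bs)  zero    .(true ∷ o′) refl p | just o′ = parkAt-occupied a bs zero o′ e p
parkAt-occupied a       (b ∷ bs)     (suc i) o eq p with parkAt bs i in e
parkAt-occupied zero    (b ∷ bs)     (suc i) .(b ∷ o′) refl p    | just o′ = p
parkAt-occupied (suc a) (b ∷ bs)     (suc i) .(b ∷ o′) refl p    | just o′ = parkAt-occupied a bs i o′ e p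

Step : Set
Step = List Bool → ℕ → Maybe (List Bool)

runs : Step → ℕ → (List Bool → ℕ) → List Bool → ℕ → ℕ
runs step N W occ zero    = W occ
runs step N W occ (suc n) = Σ< N (λ i → orZero (λ o → runs step N W o n) (step occ i))

one : List Bool → ℕ
one _ = 1

module RunsProperties (step : Step) (N : ℕ)
  (fills : ∀ occ i o → step occ i ≡ just o → suc (free o) ≡ free occ)
  (keepsLength : ∀ occ i o → step occ i ≡ just o → length o ≡ length occ) where

  runs-cong : ∀ {W W′ : List Bool → ℕ} L → (∀ s → length s ≡ L → W s ≡ W′ s) →
    ∀ occ n → length occ ≡ L → runs step N W occ n ≡ runs step N W′ occ n
  runs-cong L h occ zero    e = h occ e
  runs-cong L h occ (suc n) e =
    Σ-cong N (λ i → orZero-cong (step occ i) (λ o eo → runs-cong L h o n (trans (keepsLength occ i o eo) e)))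

  runs-Σ : ∀ J (W : ℕ → List Bool → ℕ) occ n →
    runs step N (λ s → Σ< J (λ j → W j s)) occ n ≡ Σ< J (λ j → runs step N (W j) occ n)
  runs-Σ J W occ zero    = refl
  runs-Σ J W occ (suc n) =
    trans (Σ-cong N (λ i → trans (orZero-cong (step occ i) (λ o _ → runs-Σ J W o n))
                                 (orZero-Σ J (λ o j → runs step N (W j) o n) (step occ i))))
          (Σ-swap N J _)

  -- after n successful steps exactly n spaces have been filled, so a weight
  -- depending only on the number of free spaces is a constant factor
  runs-free : ∀ (g : ℕ → ℕ) occ n → runs step N (g ∘ free) occ n ≡ g (free occ ∸ n) * runs step N one occ n
  runs-free g occ zero    = sym (*-identityʳ _)
  runs-free g occ (suc n) =
    begin
      Σ< N (λ i → orZero (λ o → runs step N (g ∘ free) o n) (step occ i))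
    ≡⟨ Σ-cong N (λ i → orZero-cong (step occ i) λ o eo →
         trans (runs-free g o n) (cong (λ z → g (z ∸ suc n) * runs step N one o n) (fills occ i o eo))) ⟩
      Σ< N (λ i → orZero (λ o → c * runs step N one o n) (step occ i))
    ≡⟨ Σ-cong N (λ i → orZero-∘ (c *_) _ (step occ i) (*-zeroʳ c)) ⟩
      Σ< N (λ i → c * orZero (λ o → runs step N one o n) (step occ i))
    ≡⟨ Σ-*ˡ N c _ ⟩
      c * runs step N one occ (suc n)
    ∎
    where
    open ≡-Reasoning
    c = g (free occ ∸ suc n)

  runs-tooMany : ∀ W occ n → free occ < n → runs step N W occ n ≡ 0
  runs-tooMany W occ (suc n) (s≤s c≤n) = Σ-zero N _ λ i _ → orZero-zero (step occ i) λ o eo →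
    runs-tooMany W o n (subst (_≤ n) (sym (fills occ i o eo)) c≤n)

  runs-vanish : (P : List Bool → Set) → (∀ s i o → step s i ≡ just o → P s → P o) →
    ∀ W → (∀ s → P s → W s ≡ 0) → ∀ occ n → P occ → runs step N W occ n ≡ 0
  runs-vanish P pres W hW occ zero    p = hW occ p
  runs-vanish P pres W hW occ (suc n) p = Σ-zero N _ λ i _ → orZero-zero (step occ i) λ o eo →
    runs-vanish P pres W hW o n (pres occ i o eo p)

  runs-allPark : (∀ occ i → 0 < free occ → ∃ (λ o → step occ i ≡ just o)) →
    ∀ occ n → n ≤ free occ → runs step N one occ n ≡ N ^ n
  runs-allPark parks occ zero    _    = refl
  runs-allPark parks occ (suc n) n<fr = trans (Σ-cong N λ i → parked i (parks occ i (≤-trans (s≤s z≤n) n<fr)))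
                                              (Σ-const N _)
    where
    parked : ∀ i → ∃ (λ o → step occ i ≡ just o) → orZero (λ o → runs step N one o n) (step occ i) ≡ N ^ n
    parked i (o , eo) rewrite eo = runs-allPark parks o n (≤-pred (subst (suc n ≤_) (sym (fills occ i o eo)) n<fr))

module Linear (N : ℕ) = RunsProperties parkAt N parkAt-fills parkAt-length

parksAll : ∀ {m k} → List Bool → Vec (Fin m) k → ℕ
parksAll occ a = 𝟙 (T? (is-just (runCars occ (map toℕ (toList a)))))

runs-enumerate : ∀ m n occ → sumList (map (parksAll occ) (allSeqs m n)) ≡ runs parkAt m one occ n
runs-enumerate m zero    occ = refl
runs-enumerate m (suc n) occ =
  trans (sumList-concatMap (parksAll occ) (λ x → map (x ∷_) (allSeqs m n)) (toList (allFin m)))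
        (sumList-tabulate m id _ _ firstCar)
  where
  firstCar : ∀ x → sumList (map (parksAll occ) (map (x ∷_) (allSeqs m n)))
                   ≡ orZero (λ o → runs parkAt m one o n) (parkAt occ (toℕ x))
  firstCar x = trans (sumList-map (parksAll occ) (x ∷_) (allSeqs m n)) (afterFirst (parkAt occ (toℕ x)) refl)
    where
    rest : Maybe (List Bool) → Vec (Fin m) n → ℕ
    rest r a = 𝟙 (T? (is-just (r >>= λ o → runCars o (map toℕ (toList a)))))
    afterFirst : ∀ r → parkAt occ (toℕ x) ≡ r →
      sumList (map (parksAll occ ∘ (x ∷_)) (allSeqs m n)) ≡ orZero (λ o → runs parkAt m one o n) r
    afterFirst (just o) e = trans (sumList-cong (allSeqs m n) (λ a → cong (λ r → rest r a) e)) (runs-enumerate m n o)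
    afterFirst nothing  e = trans (sumList-cong (allSeqs m n) (λ a → cong (λ r → rest r a) e)) (sumList-zero (allSeqs m n))

pf-runs : ∀ n m → pf n m ≡ runs parkAt m one (emptyLot m) n
pf-runs n m = trans (length-filter (λ a → T? (isPF m a)) (allSeqs m n)) (runs-enumerate m n (emptyLot m))

-- Pollak's theorem p(m,m) = (m+1)^(m-1), via circular parking

-- a car finding no free space at or after its preference continues from the
-- first space, as on a circle
parkCircular : Step
parkCircular occ i = parkAt occ i <∣> parkAt occ 0

circular-linear : ∀ occ i {o} → parkCircular occ i ≡ just o → ∃ λ j → parkAt occ j ≡ just o
circular-linear occ i eq with parkAt occ i in e
... | just x with refl ← eq = i , e
... | nothing = 0 , eq

circular-parks : ∀ occ i → 0 < free occ → ∃ λ o → parkCircular occ i ≡ just o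
circular-parks occ i fr with parkAt occ i
... | just x = x , refl
... | nothing with parkAt occ 0 in e
...   | just y  = y , refl
...   | nothing with () ← subst (0 <_) (parkAt-full occ e) fr

circular-fills : ∀ occ i o → parkCircular occ i ≡ just o → suc (free o) ≡ free occ
circular-fills occ i o eq = let (j , e) = circular-linear occ i eq in parkAt-fills occ j o e

circular-length : ∀ occ i o → parkCircular occ i ≡ just o → length o ≡ length occ
circular-length occ i o eq = let (j , e) = circular-linear occ i eq in parkAt-length occ j o e

module Circular (N : ℕ) = RunsProperties parkCircular N circular-fills circular-length

firstFree : List Bool → ℕ
firstFree (false ∷ _) = 1
firstFree _           = 0

circular-firstFree : ∀ m n st → runs parkCircular (suc m) firstFree (false ∷ st) n ≡ runs parkAt m one st n
circular-firstFree m zero    st = refl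
circular-firstFree m (suc n) st = cong₂ _+_ (firstTaken st) (Σ-cong m shifted)
  where
  firstTaken : ∀ x → runs parkCircular (suc m) firstFree (true ∷ x) n ≡ 0
  firstTaken x = Circular.runs-vanish (suc m) (Occupied 0)
    (λ s i o eq p → let (j , e) = circular-linear s i eq in parkAt-occupied 0 s j o e p)
    firstFree (λ { (true ∷ _) _ → refl }) (true ∷ x) n tt
  shifted : ∀ i → orZero (λ o → runs parkCircular (suc m) firstFree o n) (parkCircular (false ∷ st) (suc i))
                  ≡ orZero (λ o → runs parkAt m one o n) (parkAt st i)
  shifted i with parkAt st i
  ... | just o  = circular-firstFree m n o
  ... | nothing = firstTaken st

rotate : List Bool → List Bool
rotate []       = []
rotate (b ∷ bs) = bs ++ b ∷ []

rotate-length : ∀ s → length (rotate s) ≡ length s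
rotate-length []       = refl
rotate-length (b ∷ bs) = trans (length-++ bs) (+-comm (length bs) 1)

-- parking in the rotated lot with preference i is parking in the original
-- lot with preference i + 1, the last preference wrapping around to 0
rotate-shift : ∀ b bs i → i < length bs → parkCircular (bs ++ b ∷ []) i ≡ Maybe.map rotate (parkCircular (b ∷ bs) (suc i))
rotate-shift b bs i i<l rewrite parkAt-++ bs (b ∷ []) i | parkAt-++ bs (b ∷ []) 0 with parkAt bs i
... | just x = refl
... | nothing rewrite m≤n⇒m∸n≡0 (<⇒≤ i<l) with b
...   | false = refl
...   | true with parkAt bs 0
...     | just y  = refl
...     | nothing rewrite 0∸n≡0 (length bs) = refl

rotate-wrap : ∀ b bs → parkCircular (bs ++ b ∷ []) (length bs) ≡ Maybe.map rotate (parkCircular (b ∷ bs) 0)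
rotate-wrap b bs rewrite parkAt-++ bs (b ∷ []) (length bs) | parkAt-beyond bs (length bs) ≤-refl
                       | n∸n≡0 (length bs) | parkAt-++ bs (b ∷ []) 0 with b
... | false = refl
... | true with parkAt bs 0
...   | just y  = refl
...   | nothing rewrite 0∸n≡0 (length bs) = refl

runs-rotate : ∀ M (W : List Bool → ℕ) n occ → length occ ≡ suc M →
  runs parkCircular (suc M) W (rotate occ) n ≡ runs parkCircular (suc M) (W ∘ rotate) occ n
runs-rotate M W zero occ e = refl
runs-rotate .(length bs) W (suc n) (b ∷ bs) refl =
  begin
    Σ< (suc L) (λ i → orZero (R W) (parkCircular (bs ++ b ∷ []) i))
  ≡⟨ Σ-last L _ ⟩
    Σ< L (λ i → orZero (R W) (parkCircular (bs ++ b ∷ []) i)) + orZero (R W) (parkCircular (bs ++ b ∷ []) L)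
  ≡⟨ cong₂ _+_ (Σ-cong< L λ i i<L → trans (cong (orZero (R W)) (rotate-shift b bs i i<L)) (rotated (suc i)))
               (trans (cong (orZero (R W)) (rotate-wrap b bs)) (rotated 0)) ⟩
    Σ< L (λ i → orZero (R (W ∘ rotate)) (parkCircular (b ∷ bs) (suc i))) + orZero (R (W ∘ rotate)) (parkCircular (b ∷ bs) 0)
  ≡⟨ +-comm (Σ< L (λ i → orZero (R (W ∘ rotate)) (parkCircular (b ∷ bs) (suc i)))) _ ⟩
    Σ< (suc L) (λ i → orZero (R (W ∘ rotate)) (parkCircular (b ∷ bs) i))
  ∎
  where
  open ≡-Reasoning
  L = length bs
  R : (List Bool → ℕ) → List Bool → ℕ
  R V o = runs parkCircular (suc L) V o n
  rotated : ∀ j → orZero (R W) (Maybe.map rotate (parkCircular (b ∷ bs) j)) ≡ orZero (R (W ∘ rotate)) (parkCircular (b ∷ bs) j)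
  rotated j = trans (orZero-map (R W) rotate (parkCircular (b ∷ bs) j))
                    (orZero-cong (parkCircular (b ∷ bs) j) λ o eo →
                      runs-rotate L W n o (circular-length (b ∷ bs) j o eo))

rotateBy : ℕ → List Bool → List Bool
rotateBy zero    s = s
rotateBy (suc j) s = rotateBy j (rotate s)

runs-rotateBy : ∀ M j (W : List Bool → ℕ) n occ → length occ ≡ suc M →
  runs parkCircular (suc M) W (rotateBy j occ) n ≡ runs parkCircular (suc M) (W ∘ rotateBy j) occ n
runs-rotateBy M zero    W n occ e = refl
runs-rotateBy M (suc j) W n occ e =
  trans (runs-rotateBy M j W n (rotate occ) (trans (rotate-length occ) e)) (runs-rotate M (W ∘ rotateBy j) n occ e)

rotateBy-emptyLot : ∀ j M → rotateBy j (emptyLot (suc M)) ≡ emptyLot (suc M)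
rotateBy-emptyLot zero    M = refl
rotateBy-emptyLot (suc j) M = trans (cong (rotateBy j) (snoc M)) (rotateBy-emptyLot j M)
  where
  snoc : ∀ M → emptyLot M ++ false ∷ [] ≡ emptyLot (suc M)
  snoc zero    = refl
  snoc (suc M) = cong (false ∷_) (snoc M)

-- each free space of s is brought to the front by exactly one rotation
free-rotations : ∀ s → Σ< (length s) (λ j → firstFree (rotateBy j s)) ≡ free s
free-rotations s = trans (Σ-cong (length s) λ j → cong (firstFree ∘ rotateBy j) (sym (++-identityʳ s))) (prefix s [])
  where
  prefix : ∀ xs ys → Σ< (length xs) (λ j → firstFree (rotateBy j (xs ++ ys))) ≡ free xs
  prefix []       ys = refl
  prefix (b ∷ xs) ys =
    trans (cong (firstFree (b ∷ xs ++ ys) +_)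
                (trans (Σ-cong (length xs) λ j → cong (firstFree ∘ rotateBy j) (++-assoc xs ys (b ∷ [])))
                       (prefix xs (ys ++ b ∷ []))))
          (front b)
    where
    front : ∀ b → firstFree (b ∷ xs ++ ys) + free xs ≡ free (b ∷ xs)
    front false = refl
    front true  = refl

-- Pollak: the empty circular lot is fixed by its m+1 rotations, and each
-- rotation contributes p(m,m) runs leaving its first space free; together these
-- count, once per free space, every one of the (m+1)^m circular runs of m cars
pollak : ∀ m → suc m * pf m m ≡ suc m ^ m
pollak m =
  begin
    N * pf m m
  ≡⟨ cong (N *_) (trans (pf-runs m m) (sym (circular-firstFree m m (emptyLot m)))) ⟩
    N * C firstFree
  ≡⟨ sym (Σ-const N (C firstFree)) ⟩
    Σ< N (λ j → C firstFree)
  ≡⟨ Σ-cong N (λ j → trans (cong (λ s → runs parkCircular N firstFree s m) (sym (rotateBy-emptyLot j m)))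
                           (runs-rotateBy m j firstFree m (emptyLot N) (length-replicate N))) ⟩
    Σ< N (λ j → C (firstFree ∘ rotateBy j))
  ≡⟨ sym (Circular.runs-Σ N N (λ j → firstFree ∘ rotateBy j) (emptyLot N) m) ⟩
    C (λ s → Σ< N (λ j → firstFree (rotateBy j s)))
  ≡⟨ Circular.runs-cong N N (λ s e → trans (cong (λ l → Σ< l (λ j → firstFree (rotateBy j s))) (sym e)) (free-rotations s))
                        (emptyLot N) m (length-replicate N) ⟩
    C free
  ≡⟨ Circular.runs-free N id (emptyLot N) m ⟩
    (free (emptyLot N) ∸ m) * C one
  ≡⟨ cong₂ _*_ (trans (cong (_∸ m) (free-emptyLot N)) (m+n∸n≡m 1 m))
               (Circular.runs-allPark N circular-parks (emptyLot N) m (subst (m ≤_) (sym (free-emptyLot N)) (n≤1+n m))) ⟩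
    1 * N ^ m
  ≡⟨ *-identityˡ (N ^ m) ⟩
    N ^ m
  ∎
  where
  open ≡-Reasoning
  N = suc m
  C : (List Bool → ℕ) → ℕ
  C W = runs parkCircular N W (emptyLot N) m

cayley : ℕ → ℕ
cayley r = (r + 1) ^ (r ∸ 1)

pf-diagonal : ∀ m → pf m m ≡ cayley m
pf-diagonal zero    = trans (sym (+-identityʳ (pf 0 0))) (pollak 0)
pf-diagonal (suc m) = *-cancelˡ-≡ _ _ (suc (suc m))
  (trans (pollak (suc m)) (cong (λ z → suc (suc m) * z ^ m) (+-comm 1 (suc m))))

-- Splitting a lot at a free space

binomialConv : ℕ → (ℕ → ℕ) → (ℕ → ℕ) → ℕ
binomialConv n X Y = Σ< (suc n) (λ s → (n C s) * (X s * Y (n ∸ s)))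

binomialConv-pascal : ∀ n (X Y : ℕ → ℕ) →
  binomialConv n (X ∘ suc) Y + binomialConv n X (Y ∘ suc) ≡ binomialConv (suc n) X Y
binomialConv-pascal n X Y =
  begin
    S₁ + S₂
  ≡⟨ cong (S₁ +_) S₂≡ ⟩
    S₁ + (first + S₃)
  ≡⟨ +-exchange S₁ first S₃ ⟩
    first + (S₁ + S₃)
  ≡⟨ cong (first +_) (sym (Σ-+ (suc n) (λ s → (n C s) * Z s) (λ s → (n C suc s) * Z s))) ⟩
    first + Σ< (suc n) (λ s → (n C s) * Z s + (n C suc s) * Z s)
  ≡⟨ cong (first +_) (Σ-cong (suc n) λ s → trans (sym (*-distribʳ-+ (Z s) (n C s) (n C suc s))) (cong (_* Z s) (nCk+nC[k+1]≡[n+1]C[k+1] n s))) ⟩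
    first + Σ< (suc n) (λ s → (suc n C suc s) * Z s)
  ∎
  where
  open ≡-Reasoning
  Z : ℕ → ℕ
  Z s = X (suc s) * Y (n ∸ s)
  S₁ = binomialConv n (X ∘ suc) Y
  S₂ = binomialConv n X (Y ∘ suc)
  S₃ = Σ< (suc n) (λ s → (n C suc s) * Z s)
  first = 1 * (X 0 * Y (suc n))
  +-exchange : ∀ a b c → a + (b + c) ≡ b + (a + c)
  +-exchange = solve-∀
  -- drop the s = 0 term of S₂ and reindex; the new last term has C(n, n+1) = 0
  S₂≡ : S₂ ≡ first + S₃
  S₂≡ =
    begin
      S₂
    ≡⟨⟩
      first + Σ< n (λ s → (n C suc s) * (X (suc s) * Y (suc (n ∸ suc s))))
    ≡⟨ cong (first +_) (Σ-cong< n λ s s<n → cong (λ d → (n C suc s) * (X (suc s) * Y d)) (sym (+-∸-assoc 1 s<n))) ⟩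
      first + Σ< n (λ s → (n C suc s) * Z s)
    ≡⟨ cong (first +_) (sym (+-identityʳ _)) ⟩
      first + (Σ< n (λ s → (n C suc s) * Z s) + 0)
    ≡⟨ cong (λ z → first + (Σ< n (λ s → (n C suc s) * Z s) + z)) (sym (cong (_* Z n) (k>n⇒nCk≡0 (n<1+n n)))) ⟩
      first + (Σ< n (λ s → (n C suc s) * Z s) + (n C suc n) * Z n)
    ≡⟨ cong (first +_) (sym (Σ-last n _)) ⟩
      first + S₃
    ∎

-- weight on a lot A ++ g ∷ B with |A| = a: the weights of the two parts,
-- provided the separating space g is free
splitWeight : ℕ → (List Bool → ℕ) → (List Bool → ℕ) → List Bool → ℕ
splitWeight a WA WB s = WA (take a s) * (firstFree (drop a s) * WB (drop (suc a) s))

splitWeight-++ : ∀ WA WB A g B → splitWeight (length A) WA WB (A ++ g ∷ B) ≡ WA A * (firstFree (g ∷ B) * WB B)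
splitWeight-++ WA WB []      g B = refl
splitWeight-++ WA WB (x ∷ A) g B = splitWeight-++ (WA ∘ (x ∷_)) WB A g B

occupied-firstFree : ∀ a s → Occupied a s → firstFree (drop a s) ≡ 0
occupied-firstFree zero    (true ∷ s) _ = refl
occupied-firstFree (suc a) (x ∷ s)    p = occupied-firstFree a s p

occupied-middle : ∀ A B → Occupied (length A) (A ++ true ∷ B)
occupied-middle []      B = tt
occupied-middle (x ∷ A) B = occupied-middle A B

Σ-orZero-swap : {L : Set} (K M : ℕ) (r : ℕ → Maybe L) (f : L → ℕ → ℕ) →
  Σ< K (λ i → orZero (λ o → Σ< M (f o)) (r i)) ≡ Σ< M (λ s → Σ< K (λ i → orZero (λ o → f o s) (r i)))
Σ-orZero-swap K M r f = trans (Σ-cong K λ i → orZero-Σ M f (r i)) (Σ-swap K M _)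

-- As long as the separating space stays free, cars preferring a space of A
-- park in A and cars preferring a space of B park in B; the two parts evolve
-- independently and their runs interleave binomially.
module Split (WA WB : List Bool → ℕ) (a b : ℕ) where

  R : List Bool → ℕ → ℕ
  R o n = runs parkAt (a + suc b) (splitWeight a WA WB) o n

  RA : List Bool → ℕ → ℕ
  RA o n = runs parkAt a WA o n

  RB : List Bool → ℕ → ℕ
  RB o n = runs parkAt b WB o n

  gapTaken : ∀ A B n → length A ≡ a → R (A ++ true ∷ B) n ≡ 0
  gapTaken A B n refl = Linear.runs-vanish (a + suc b) (Occupied a) (parkAt-occupied a) (splitWeight a WA WB)
    (λ s p → trans (cong (λ z → WA (take a s) * (z * WB (drop (suc a) s))) (occupied-firstFree a s p)) (*-zeroʳ (WA (take a s))))
    (A ++ true ∷ B) n (occupied-middle A B)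

  leftCar : ∀ A B n i → length A ≡ a → i < a →
    orZero (λ o → R o n) (parkAt (A ++ false ∷ B) i) ≡ orZero (λ A′ → R (A′ ++ false ∷ B) n) (parkAt A i)
  leftCar A B n i e i<a rewrite parkAt-++ A (false ∷ B) i with parkAt A i
  ... | just A′ = refl
  ... | nothing rewrite m≤n⇒m∸n≡0 (<⇒≤ (subst (i <_) (sym e) i<a)) = gapTaken A B n e

  gapCar : ∀ A B n → length A ≡ a → orZero (λ o → R o n) (parkAt (A ++ false ∷ B) (a + 0)) ≡ 0
  gapCar A B n e rewrite parkAt-++ A (false ∷ B) (a + 0) | parkAt-beyond A (a + 0) (subst (_≤ a + 0) (sym e) (m≤m+n a 0))
                       | e | m+n∸m≡n a 0 = gapTaken A B n e

  rightCar : ∀ A B n j → length A ≡ a →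
    orZero (λ o → R o n) (parkAt (A ++ false ∷ B) (a + suc j)) ≡ orZero (λ B′ → R (A ++ false ∷ B′) n) (parkAt B j)
  rightCar A B n j e rewrite parkAt-++ A (false ∷ B) (a + suc j) | parkAt-beyond A (a + suc j) (subst (_≤ a + suc j) (sym e) (m≤m+n a (suc j)))
                           | e | m+n∸m≡n a (suc j) with parkAt B j
  ... | just B′ = refl
  ... | nothing = refl

  Split : ℕ → Set
  Split n = ∀ A B → length A ≡ a → length B ≡ b → R (A ++ false ∷ B) n ≡ binomialConv n (RA A) (RB B)

  leftCars : ∀ n → Split n → ∀ A B → length A ≡ a → length B ≡ b →
    Σ< a (λ i → orZero (λ o → R o n) (parkAt (A ++ false ∷ B) i)) ≡ binomialConv n (RA A ∘ suc) (RB B)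
  leftCars n ih A B ea eb =
    begin
      Σ< a (λ i → orZero (λ o → R o n) (parkAt (A ++ false ∷ B) i))
    ≡⟨ Σ-cong< a (λ i i<a → trans (leftCar A B n i ea i<a)
                  (orZero-cong (parkAt A i) λ A′ e → ih A′ B (trans (parkAt-length A i A′ e) ea) eb)) ⟩
      Σ< a (λ i → orZero (λ A′ → binomialConv n (RA A′) (RB B)) (parkAt A i))
    ≡⟨ Σ-orZero-swap a (suc n) (parkAt A) (λ A′ s → (n C s) * (RA A′ s * RB B (n ∸ s))) ⟩
      Σ< (suc n) (λ s → Σ< a (λ i → orZero (λ A′ → (n C s) * (RA A′ s * RB B (n ∸ s))) (parkAt A i)))
    ≡⟨ Σ-cong (suc n) (λ s → Σ-cong a λ i →
         orZero-∘ (λ z → (n C s) * (z * RB B (n ∸ s))) (λ A′ → RA A′ s) (parkAt A i) (*-zeroʳ (n C s))) ⟩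
      Σ< (suc n) (λ s → Σ< a (λ i → (n C s) * (orZero (λ A′ → RA A′ s) (parkAt A i) * RB B (n ∸ s))))
    ≡⟨ Σ-cong (suc n) (λ s → let f i = orZero (λ A′ → RA A′ s) (parkAt A i) in
         trans (Σ-*ˡ a (n C s) (λ i → f i * RB B (n ∸ s))) (cong ((n C s) *_) (Σ-*ʳ a (RB B (n ∸ s)) f))) ⟩
      binomialConv n (RA A ∘ suc) (RB B)
    ∎
    where open ≡-Reasoning

  rightCars : ∀ n → Split n → ∀ A B → length A ≡ a → length B ≡ b →
    Σ< b (λ j → orZero (λ o → R o n) (parkAt (A ++ false ∷ B) (a + suc j))) ≡ binomialConv n (RA A) (RB B ∘ suc)
  rightCars n ih A B ea eb =
    begin
      Σ< b (λ j → orZero (λ o → R o n) (parkAt (A ++ false ∷ B) (a + suc j)))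
    ≡⟨ Σ-cong b (λ j → trans (rightCar A B n j ea)
                  (orZero-cong (parkAt B j) λ B′ e → ih A B′ ea (trans (parkAt-length B j B′ e) eb))) ⟩
      Σ< b (λ j → orZero (λ B′ → binomialConv n (RA A) (RB B′)) (parkAt B j))
    ≡⟨ Σ-orZero-swap b (suc n) (parkAt B) (λ B′ s → (n C s) * (RA A s * RB B′ (n ∸ s))) ⟩
      Σ< (suc n) (λ s → Σ< b (λ j → orZero (λ B′ → (n C s) * (RA A s * RB B′ (n ∸ s))) (parkAt B j)))
    ≡⟨ Σ-cong (suc n) (λ s → Σ-cong b λ j →
         orZero-∘ (λ z → (n C s) * (RA A s * z)) (λ B′ → RB B′ (n ∸ s)) (parkAt B j)
                  (trans (cong ((n C s) *_) (*-zeroʳ (RA A s))) (*-zeroʳ (n C s)))) ⟩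
      Σ< (suc n) (λ s → Σ< b (λ j → (n C s) * (RA A s * orZero (λ B′ → RB B′ (n ∸ s)) (parkAt B j))))
    ≡⟨ Σ-cong (suc n) (λ s → let f j = orZero (λ B′ → RB B′ (n ∸ s)) (parkAt B j) in
         trans (Σ-*ˡ b (n C s) (λ j → RA A s * f j)) (cong ((n C s) *_) (Σ-*ˡ b (RA A s) f))) ⟩
      binomialConv n (RA A) (RB B ∘ suc)
    ∎
    where open ≡-Reasoning

  runs-split : ∀ n → Split n
  runs-split zero    A B refl eb =
    trans (splitWeight-++ WA WB A false B)
          (trans (cong (WA A *_) (*-identityˡ (WB B))) (sym (trans (+-identityʳ _) (*-identityˡ _))))
  runs-split (suc n) A B ea eb =
    begin
      Σ< (a + suc b) (λ i → car i)
    ≡⟨ Σ-split a (suc b) car ⟩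
      Σ< a car + (car (a + 0) + Σ< b (λ j → car (a + suc j)))
    ≡⟨ cong₂ _+_ (leftCars n (runs-split n) A B ea eb) (cong₂ _+_ (gapCar A B n ea) (rightCars n (runs-split n) A B ea eb)) ⟩
      binomialConv n (RA A ∘ suc) (RB B) + binomialConv n (RA A) (RB B ∘ suc)
    ≡⟨ binomialConv-pascal n (RA A) (RB B) ⟩
      binomialConv (suc n) (RA A) (RB B)
    ∎
    where
    open ≡-Reasoning
    car : ℕ → ℕ
    car i = orZero (λ o → R o n) (parkAt (A ++ false ∷ B) i)

-- Decomposition of p(n, n+k+1) by the first space left free

isZero : ℕ → ℕ
isZero zero    = 1
isZero (suc _) = 0

isPos : ℕ → ℕ
isPos zero    = 0
isPos (suc _) = 1

-- weight: space j (counted from 0) is the first free space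
firstFreeAt : ℕ → List Bool → ℕ
firstFreeAt j = splitWeight j (isZero ∘ free) one

firstFreeAt-Σ : ∀ s → Σ< (length s) (λ j → firstFreeAt j s) ≡ isPos (free s)
firstFreeAt-Σ []          = refl
firstFreeAt-Σ (false ∷ s) = cong (1 +_) (Σ-zero (length s) _ λ _ _ → refl)
firstFreeAt-Σ (true ∷ s)  = firstFreeAt-Σ s

-- with fewer cars than spaces some space stays free, so every successful run
-- is counted once according to its first free space
pf-firstFree : ∀ n m → n < m → pf n m ≡ Σ< m (λ j → runs parkAt m (firstFreeAt j) (emptyLot m) n)
pf-firstFree n m n<m =
  begin
    pf n m
  ≡⟨ pf-runs n m ⟩
    runs parkAt m one (emptyLot m) n
  ≡⟨ sym (trans (Linear.runs-free m isPos (emptyLot m) n)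
                (trans (cong (λ f → isPos (f ∸ n) * runs parkAt m one (emptyLot m) n) (free-emptyLot m))
                       (trans (cong (λ d → isPos d * runs parkAt m one (emptyLot m) n) (+-∸-assoc 1 n<m)) (+-identityʳ _)))) ⟩
    runs parkAt m (isPos ∘ free) (emptyLot m) n
  ≡⟨ Linear.runs-cong m m (λ s e → trans (sym (firstFreeAt-Σ s)) (cong (λ l → Σ< l (λ j → firstFreeAt j s)) e))
                      (emptyLot m) n (length-replicate m) ⟩
    runs parkAt m (λ s → Σ< m (λ j → firstFreeAt j s)) (emptyLot m) n
  ≡⟨ Linear.runs-Σ m m firstFreeAt (emptyLot m) n ⟩
    Σ< m (λ j → runs parkAt m (firstFreeAt j) (emptyLot m) n)
  ∎
  where open ≡-Reasoning

prefixRuns : ℕ → ℕ → ℕ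
prefixRuns j s = runs parkAt j (isZero ∘ free) (emptyLot j) s

prefixRuns-free : ∀ j s → prefixRuns j s ≡ isZero (j ∸ s) * runs parkAt j one (emptyLot j) s
prefixRuns-free j s = trans (Linear.runs-free j isZero (emptyLot j) s)
                            (cong (λ f → isZero (f ∸ s) * runs parkAt j one (emptyLot j) s) (free-emptyLot j))

prefixRuns-diagonal : ∀ j → prefixRuns j j ≡ pf j j
prefixRuns-diagonal j = trans (prefixRuns-free j j)
  (trans (cong (λ d → isZero d * runs parkAt j one (emptyLot j) j) (n∸n≡0 j)) (trans (+-identityʳ _) (sym (pf-runs j j))))

-- fewer cars leave a space free, more cars cannot all park
prefixRuns-off : ∀ j s → s ≢ j → prefixRuns j s ≡ 0
prefixRuns-off j s s≢j with <-cmp s j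
... | tri< s<j _ _ = trans (prefixRuns-free j s)
                           (cong (λ d → isZero d * runs parkAt j one (emptyLot j) s) (+-∸-assoc 1 s<j))
... | tri≈ _ s≡j _ = ⊥-elim (s≢j s≡j)
... | tri> _ _ j<s = trans (prefixRuns-free j s)
                           (trans (cong (isZero (j ∸ s) *_)
                                        (Linear.runs-tooMany j one (emptyLot j) s (subst (_< s) (sym (free-emptyLot j)) j<s)))
                                  (*-zeroʳ (isZero (j ∸ s))))

binomialConv-prefix : ∀ n j Y → j ≤ n → binomialConv n (prefixRuns j) Y ≡ (n C j) * (pf j j * Y (n ∸ j))
binomialConv-prefix n j Y j≤n =
  trans (Σ-single (suc n) j _ (s≤s j≤n) λ s _ s≢j →
           trans (cong (λ p → (n C s) * (p * Y (n ∸ s))) (prefixRuns-off j s s≢j)) (*-zeroʳ (n C s)))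
        (cong (λ p → (n C j) * (p * Y (n ∸ j))) (prefixRuns-diagonal j))

binomialConv-prefix-0 : ∀ n j Y → n < j → binomialConv n (prefixRuns j) Y ≡ 0
binomialConv-prefix-0 n j Y n<j = Σ-zero (suc n) _ λ s s≤n →
  trans (cong (λ p → (n C s) * (p * Y (n ∸ s))) (prefixRuns-off j s λ { refl → <⇒≱ n<j (≤-pred s≤n) }))
        (*-zeroʳ (n C s))

emptyLot-split : ∀ a b → emptyLot (a + suc b) ≡ emptyLot a ++ false ∷ emptyLot b
emptyLot-split zero    b = refl
emptyLot-split (suc a) b = cong (false ∷_) (emptyLot-split a b)

-- if space j is the first free one, the j spaces before it are filled by
-- some s of the cars, and the other cars park on the m - j - 1 spaces after it
runs-firstFreeAt : ∀ m j n → j < m →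
  runs parkAt m (firstFreeAt j) (emptyLot m) n ≡ binomialConv n (prefixRuns j) (λ s → pf s (m ∸ suc j))
runs-firstFreeAt m j n j<m = split m (sym (trans (+-suc j (m ∸ suc j)) (m+[n∸m]≡n j<m)))
  where
  split : ∀ m′ → m′ ≡ j + suc (m ∸ suc j) →
    runs parkAt m′ (firstFreeAt j) (emptyLot m′) n ≡ binomialConv n (prefixRuns j) (λ s → pf s (m ∸ suc j))
  split .(j + suc (m ∸ suc j)) refl rewrite emptyLot-split j (m ∸ suc j) =
    trans (Split.runs-split (isZero ∘ free) one j b n (emptyLot j) (emptyLot b) (length-replicate j) (length-replicate b))
          (Σ-cong (suc n) λ s → cong (λ p → (n C s) * (prefixRuns j s * p)) (sym (pf-runs (n ∸ s) b)))
    where b = m ∸ suc j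

pf-decompose : ∀ n k → pf n (n + suc k) ≡ Σ< (suc n) (λ j → (n C j) * (pf j j * pf (n ∸ j) (n ∸ j + k)))
pf-decompose n k =
  begin
    pf n m
  ≡⟨ pf-firstFree n m (subst (n <_) (sym (+-suc n k)) (s≤s (m≤m+n n k))) ⟩
    Σ< m F
  ≡⟨ cong (λ l → Σ< l F) (+-suc n k) ⟩
    Σ< (suc n + k) F
  ≡⟨ Σ-split (suc n) k F ⟩
    Σ< (suc n) F + Σ< k (λ i → F (suc n + i))
  ≡⟨ cong₂ _+_ (Σ-cong< (suc n) early) (Σ-zero k _ late) ⟩
    Σ< (suc n) (λ j → (n C j) * (pf j j * pf (n ∸ j) (n ∸ j + k))) + 0
  ≡⟨ +-identityʳ _ ⟩
    Σ< (suc n) (λ j → (n C j) * (pf j j * pf (n ∸ j) (n ∸ j + k)))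
  ∎
  where
  open ≡-Reasoning
  m = n + suc k
  F : ℕ → ℕ
  F j = runs parkAt m (firstFreeAt j) (emptyLot m) n
  early : ∀ j → j < suc n → F j ≡ (n C j) * (pf j j * pf (n ∸ j) (n ∸ j + k))
  early j (s≤s j≤n) =
    trans (runs-firstFreeAt m j n (subst (j <_) (sym (+-suc n k)) (s≤s (≤-trans j≤n (m≤m+n n k)))))
          (trans (binomialConv-prefix n j (λ s → pf s (m ∸ suc j)) j≤n)
                 (cong (λ l → (n C j) * (pf j j * pf (n ∸ j) l)) (trans (cong (_∸ suc j) (+-suc n k)) (+-∸-comm k j≤n))))
  late : ∀ i → i < k → F (suc n + i) ≡ 0
  late i i<k = trans (runs-firstFreeAt m (suc n + i) n (subst (suc n + i <_) (sym (+-suc n k)) (s≤s (+-monoʳ-< n i<k))))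
                     (binomialConv-prefix-0 n (suc n + i) (λ s → pf s (m ∸ suc (suc n + i))) (s≤s (m≤m+n n i)))

𝟙-yes : {P : Set} → P → (d : Dec P) → 𝟙 d ≡ 1
𝟙-yes p (yes _) = refl
𝟙-yes p (no ¬p) = ⊥-elim (¬p p)

𝟙-no : {P : Set} → ¬ P → (d : Dec P) → 𝟙 d ≡ 0
𝟙-no ¬p (yes p) = ⊥-elim (¬p p)
𝟙-no ¬p (no _)  = refl

𝟙-⇔ : {P Q : Set} → (P → Q) → (Q → P) → (d : Dec P) (d′ : Dec Q) → 𝟙 d ≡ 𝟙 d′
𝟙-⇔ to from (yes p) d′ = sym (𝟙-yes (to p) d′)
𝟙-⇔ to from (no ¬p) d′ = sym (𝟙-no (¬p ∘ from) d′)

𝟙-*-cong : {P : Set} (d : Dec P) {x y : ℕ} → (P → x ≡ y) → 𝟙 d * x ≡ 𝟙 d * y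
𝟙-*-cong (yes p) eq = cong (_+ 0) (eq p)
𝟙-*-cong (no _)  eq = refl

-- Σcomp l t f: the sum of f over all compositions of t into l parts,
-- organised by the value of the first part
Σcomp : ∀ l → ℕ → (Vec ℕ l → ℕ) → ℕ
Σcomp zero    t f = isZero t * f []
Σcomp (suc l) t f = Σ< (suc t) (λ x → Σcomp l (t ∸ x) (λ r → f (x ∷ r)))

Σcomp-cong : ∀ l t {f g : Vec ℕ l → ℕ} → (∀ r → f r ≡ g r) → Σcomp l t f ≡ Σcomp l t g
Σcomp-cong zero    t h = cong (isZero t *_) (h [])
Σcomp-cong (suc l) t h = Σ-cong (suc t) λ x → Σcomp-cong l (t ∸ x) (λ r → h (x ∷ r))

Σcomp-*ˡ : ∀ l t c (f : Vec ℕ l → ℕ) → Σcomp l t (λ r → c * f r) ≡ c * Σcomp l t f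
Σcomp-*ˡ zero    t c f = x*[y*z]≡y*[x*z] (isZero t) c (f [])
  where
  x*[y*z]≡y*[x*z] : ∀ x y z → x * (y * z) ≡ y * (x * z)
  x*[y*z]≡y*[x*z] = solve-∀
Σcomp-*ˡ (suc l) t c f = trans (Σ-cong (suc t) λ x → Σcomp-*ˡ l (t ∸ x) c (λ r → f (x ∷ r))) (Σ-*ˡ (suc t) c (λ x → Σcomp l (t ∸ x) (λ r → f (x ∷ r))))

sumBelow : ℕ → ∀ l → ℕ → (Vec ℕ l → ℕ) → ℕ
sumBelow b l t f = sumList (map (λ r → 𝟙 (Vec.sum r ≟ t) * f r) (vecsBelow b l))

sumBelow-cons : ∀ b l t (f : Vec ℕ (suc l) → ℕ) →
  sumBelow b (suc l) t f ≡ Σ< b (λ x → sumList (map (λ r → 𝟙 (x + Vec.sum r ≟ t) * f (x ∷ r)) (vecsBelow b l)))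
sumBelow-cons b l t f =
  trans (sumList-concatMap (λ r → 𝟙 (Vec.sum r ≟ t) * f r) (λ x → map (x ∷_) (vecsBelow b l)) (upTo b))
  (trans (sumList-upTo _ b) (Σ-cong b λ x → sumList-map (λ r → 𝟙 (Vec.sum r ≟ t) * f r) (x ∷_) (vecsBelow b l)))

-- once the bound b exceeds t it is irrelevant: every composition of t is listed
sumBelow-Σcomp : ∀ l t b (f : Vec ℕ l → ℕ) → t < b → sumBelow b l t f ≡ Σcomp l t f
sumBelow-Σcomp zero t b f _ = trans (+-identityʳ _) (cong (_* f []) (indicator t))
  where
  indicator : ∀ t → 𝟙 (0 ≟ t) ≡ isZero t
  indicator zero    = 𝟙-yes refl (0 ≟ 0)
  indicator (suc t) = 𝟙-no (λ ()) (0 ≟ suc t)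
sumBelow-Σcomp (suc l) t b f t<b =
  begin
    sumBelow b (suc l) t f
  ≡⟨ sumBelow-cons b l t f ⟩
    Σ< b g
  ≡⟨ cong (λ c → Σ< c g) (sym (m+[n∸m]≡n t<b)) ⟩
    Σ< (suc t + (b ∸ suc t)) g
  ≡⟨ Σ-split (suc t) (b ∸ suc t) g ⟩
    Σ< (suc t) g + Σ< (b ∸ suc t) (λ i → g (suc t + i))
  ≡⟨ cong₂ _+_ (Σ-cong< (suc t) first≤t) (Σ-zero (b ∸ suc t) _ first>t) ⟩
    Σ< (suc t) (λ x → sumBelow b l (t ∸ x) (λ r → f (x ∷ r))) + 0
  ≡⟨ trans (+-identityʳ _) (Σ-cong< (suc t) λ x x≤t →
       sumBelow-Σcomp l (t ∸ x) b (λ r → f (x ∷ r)) (≤-<-trans (m∸n≤m t x) t<b)) ⟩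
    Σcomp (suc l) t f
  ∎
  where
  open ≡-Reasoning
  g : ℕ → ℕ
  g x = sumList (map (λ r → 𝟙 (x + Vec.sum r ≟ t) * f (x ∷ r)) (vecsBelow b l))
  first≤t : ∀ x → x < suc t → g x ≡ sumBelow b l (t ∸ x) (λ r → f (x ∷ r))
  first≤t x (s≤s x≤t) = sumList-cong (vecsBelow b l) λ r →
    cong (_* f (x ∷ r)) (𝟙-⇔ (λ e → trans (sym (m+n∸m≡n x _)) (cong (_∸ x) e))
                             (λ e → trans (cong (x +_) e) (m+[n∸m]≡n x≤t)) (x + Vec.sum r ≟ t) (Vec.sum r ≟ t ∸ x))
  first>t : ∀ i → i < b ∸ suc t → g (suc t + i) ≡ 0
  first>t i _ = trans (sumList-cong (vecsBelow b l) λ r →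
                  cong (_* f (suc t + i ∷ r)) (𝟙-no (λ e → <⇒≱ (s≤s (m≤m+n t i)) (subst (suc t + i ≤_) e (m≤m+n _ _)))
                                                    (suc t + i + Vec.sum r ≟ t)))
                      (sumList-zero (vecsBelow b l))

multinomial′ : ∀ {l} → ℕ → Vec ℕ l → ℕ
multinomial′ n []      = 1
multinomial′ n (x ∷ r) = (n C x) * multinomial′ (n ∸ x) r

binomial-factorials : ∀ n k → k ≤ n → (n C k) * (k ! * (n ∸ k) !) ≡ n !
binomial-factorials n k k≤n =
  trans (cong (_* (k ! * (n ∸ k) !)) (nCk≡n!/k![n-k]! k≤n)) (m/n*n≡m {{k !* (n ∸ k) !≢0}} (k![n∸k]!∣n! k≤n))

multinomial′-factorials : ∀ {l} n (r : Vec ℕ l) → Vec.sum r ≡ n → multinomial′ n r * prodFact r ≡ n !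
multinomial′-factorials n       []      refl = refl
multinomial′-factorials .(x + Vec.sum r) (x ∷ r) refl =
  begin
    (n C x) * multinomial′ (n ∸ x) r * (x ! * prodFact r)
  ≡⟨ regroup (n C x) (multinomial′ (n ∸ x) r) (x !) (prodFact r) ⟩
    (n C x) * (x ! * (multinomial′ (n ∸ x) r * prodFact r))
  ≡⟨ cong (λ p → (n C x) * (x ! * p)) (multinomial′-factorials (n ∸ x) r (sym (m+n∸m≡n x (Vec.sum r)))) ⟩
    (n C x) * (x ! * (n ∸ x) !)
  ≡⟨ binomial-factorials n x (m≤m+n x (Vec.sum r)) ⟩
    n !
  ∎
  where
  open ≡-Reasoning
  n = x + Vec.sum r
  regroup : ∀ b m f p → b * m * (f * p) ≡ b * (f * (m * p))
  regroup = solve-∀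

multinomial-eq : ∀ {l} n (r : Vec ℕ l) → Vec.sum r ≡ n → multinomial n r ≡ multinomial′ n r
multinomial-eq n r e =
  trans (cong (λ z → _/_ z (prodFact r) {{prodFact≢0 r}}) (sym (multinomial′-factorials n r e)))
        (m*n/n≡m (multinomial′ n r) (prodFact r) {{prodFact≢0 r}})

term : ∀ {l} → ℕ → Vec ℕ l → ℕ
term n r = multinomial′ n r * prodTerm r

rhs-Σcomp : ∀ n k → rhs n k ≡ Σcomp (suc k) n (term n)
rhs-Σcomp n k =
  trans (sumList-filter (λ r → Vec.sum r ≟ n) (λ r → multinomial n r * prodTerm r) (vecsBelow (suc n) (suc k)))
  (trans (sumList-cong (vecsBelow (suc n) (suc k)) λ r →
            𝟙-*-cong (Vec.sum r ≟ n) λ e → cong (_* prodTerm r) (multinomial-eq n r e))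
         (sumBelow-Σcomp (suc k) n (suc n) (term n) ≤-refl))

Σcomp-one : ∀ n → Σcomp 1 n (term n) ≡ cayley n
Σcomp-one n = trans (Σ-single (suc n) n _ ≤-refl other) last
  where
  other : ∀ x → x < suc n → x ≢ n → isZero (n ∸ x) * term n (x ∷ []) ≡ 0
  other x (s≤s x≤n) x≢n = cong (λ d → isZero d * term n (x ∷ [])) (+-∸-assoc 1 (≤∧≢⇒< x≤n x≢n))
  last : isZero (n ∸ n) * term n (n ∷ []) ≡ cayley n
  last = trans (cong (λ d → isZero d * term n (n ∷ [])) (n∸n≡0 n))
               (trans (+-identityʳ _) (trans (cong (λ b → b * 1 * (cayley n * 1)) (nCn≡1 n)) (lem (cayley n))))
    where
    lem : ∀ c → 1 * 1 * (c * 1) ≡ c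
    lem = solve-∀

Σcomp-cons : ∀ n k → Σcomp (suc (suc k)) n (term n) ≡ Σ< (suc n) (λ j → (n C j) * (cayley j * Σcomp (suc k) (n ∸ j) (term (n ∸ j))))
Σcomp-cons n k = Σ-cong (suc n) λ j →
  trans (Σcomp-cong (suc k) (n ∸ j) (λ r → regroup (n C j) (multinomial′ (n ∸ j) r) (cayley j) (prodTerm r)))
        (trans (Σcomp-*ˡ (suc k) (n ∸ j) ((n C j) * cayley j) (term (n ∸ j))) (*-assoc (n C j) (cayley j) _))
  where
  regroup : ∀ b m c p → b * m * (c * p) ≡ (b * c) * (m * p)
  regroup = solve-∀

-- induction on k: Pollak for k = 0, the first-free-space decomposition
-- matched against the first part of a composition for k + 1
pf-compositions : ∀ k n → pf n (n + k) ≡ Σcomp (suc k) n (term n)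
pf-compositions zero    n = trans (cong (pf n) (+-identityʳ n)) (trans (pf-diagonal n) (sym (Σcomp-one n)))
pf-compositions (suc k) n =
  begin
    pf n (n + suc k)
  ≡⟨ pf-decompose n k ⟩
    Σ< (suc n) (λ j → (n C j) * (pf j j * pf (n ∸ j) (n ∸ j + k)))
  ≡⟨ Σ-cong (suc n) (λ j → cong ((n C j) *_) (cong₂ _*_ (pf-diagonal j) (pf-compositions k (n ∸ j)))) ⟩
    Σ< (suc n) (λ j → (n C j) * (cayley j * Σcomp (suc k) (n ∸ j) (term (n ∸ j))))
  ≡⟨ sym (Σcomp-cons n k) ⟩
    Σcomp (suc (suc k)) n (term n)
  ∎
  where open ≡-Reasoning

lemma2p2 : (n k : ℕ) → pf n (n + k) ≡ rhs n k
lemma2p2 n k = trans (pf-compositions k n) (sym (rhs-Σcomp n k))
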